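{- Let $K_t(\omega)$ be a complete graph on vertex set $[t]$ whose edges have weights $\omega(i,j)\in\{\frac12,1\}$. Suppose that $K_t(\omega)$ contains $p$ copies of $C_5$, $q$ copies of $K_4$, $r$ copies of $K_3$ and $s$ edges, all of these $p+q+r+s$ subgraphs pairwise vertex-disjoint, and such that every edge of each of these subgraphs has weight $\frac12$. Then $$2g(K_t(\omega))\le 1-\frac{30}{30t-75p-72q-45r-20s}.$$
   Context: For a complete graph $K_t(\omega)$ on $[t]$ with edge weights $\omega(i,j)\in\{\frac12,1\}$, its edge density is $g(K_t(\omega))=\max_{\mathbf u}\sum_{1\le i<j\le t}\omega(i,j)u_iu_j$, the maximum over all vectors $\mathbf u=(u_1,\dots,u_t)$ with $u_i\ge0$ and $\sum_i u_i=1$. An edge of weight $\frac12$ is called half, of weight $1$ full. For a copy of $C_5$ only its five cycle edges are required to be half.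
   Formalization: The vectors $\mathbf u$ in the definition of $g(K_t(\omega))$ have rational entries, and the bound is asserted for each such vector. -}

module Defs where

open import Data.Nat using (ℕ; zero; suc)
open import Data.Fin using (Fin; zero; suc; toℕ)
open import Data.Bool using (if_then_else_)
open import Data.Nat.Base using (_<ᵇ_)
open import Data.Integer using (ℤ; +_; _-_)
open import Data.Rational using (ℚ; 0ℚ; _+_; _*_; _/_)

sumFin : (n : ℕ) → (Fin n → ℚ) → ℚ
sumFin zero    f = 0ℚ
sumFin (suc n) f = f zero + sumFin n (λ i → f (suc i))

lagrangian : (t : ℕ) → (Fin t → Fin t → ℚ) → (Fin t → ℚ) → ℚ
lagrangian t ω u =
  sumFin t (λ i → sumFin t (λ j →
    if toℕ i <ᵇ toℕ j then ω i j * u i * u j else 0ℚ))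

-- cyclic successor on Fin 5 (the C5 cycle edges are {k, next5 k})
next5 : Fin 5 → Fin 5
next5 zero = suc zero
next5 (suc zero) = suc (suc zero)
next5 (suc (suc zero)) = suc (suc (suc zero))
next5 (suc (suc (suc zero))) = suc (suc (suc (suc zero)))
next5 (suc (suc (suc (suc zero)))) = zero

denom : (t p q r s : ℕ) → ℚ
denom t p q r s =
  ((+ (30 Data.Nat.* t)) - (+ (75 Data.Nat.* p)) - (+ (72 Data.Nat.* q))
     - (+ (45 Data.Nat.* r)) - (+ (20 Data.Nat.* s))) / 1

two thirty : ℚ
two = (+ 2) / 1
thirty = (+ 30) / 1

-- Let L be the Lagrangian at u and, for μ ∈ ℚ, let the excess of a vertex be
--   excess μ i = Σⱼ (1 − ω i j) uᵢ uⱼ − 2μ uᵢ + μ²   (with ω i i read as 0).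
-- Then Σᵢ excess μ i = 1 − 2L − 2μ + t μ², and excess μ i ≥ (uᵢ − μ)² ≥ 0.
-- Keep in the inner sum only the vertices of one block, whose internal edges have weight ½.
-- For a C₅ the restricted excess telescopes to 5/2 μ² plus the squares ½ (uₐ + uₐ₊₁ − μ)²
-- summed around the cycle; for K₄, K₃, K₂ completing squares in the block total bounds it
-- below by k(k−1)/(k+1) μ² = 12/5, 3/2, 2/3 μ².  Summing over the disjoint blocks and
-- discarding the other vertices gives, with D = 30t − 75p − 72q − 45r − 20s,
--   60 μ ≤ 30 (1 − 2L) + D μ²   for every μ.
-- Taking μ = 1 shows D ≥ 30, and μ = 30/D gives 2L ≤ 1 − 30/D.

module Submission where

open import Defs
open import Data.Nat using (ℕ)
open import Data.Fin using (Fin)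
open import Data.Product using (_×_; _,_; Σ)
open import Data.Sum using (_⊎_; inj₁; inj₂)
open import Relation.Binary.PropositionalEquality using (_≡_; _≢_)
open import Function.Definitions using (Injective)
open import Data.Rational using (ℚ; ½; 1ℚ; 0ℚ; _≤_; _<_; _*_; _-_; _÷_; >-nonZero)

open import Algebra.Bundles using (Ring)
open import Data.Bool using (true; false; if_then_else_)
open import Data.Fin using (zero; suc; toℕ; splitAt; join; remQuot; quotRem; combine; punchIn; punchOut)
open import Data.Fin.Patterns using (0F; 1F; 2F)
open import Data.Fin.Permutation using (Permutation; permutation; _⟨$⟩ʳ_; _⟨$⟩ˡ_; inverseˡ; inverseʳ)
import Data.Fin.Properties as Fin
open import Data.Fin.Properties
  using (toℕ-injective; suc-injective; punchInᵢ≢i; punchIn-punchOut; punchOut-injective; join-splitAt; combine-remQuot)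
open import Data.Integer as ℤ using (ℤ; -[1+_])
import Data.Integer.Properties as ℤ
import Data.Nat as ℕ
open import Data.Nat using (_<ᵇ_)
import Data.Nat.Coprimality as Coprime
import Data.Nat.Properties as ℕ
import Data.Product as Product
open import Data.Product using (swap; uncurry)
open import Data.Product.Properties using (,-injectiveʳ)
open import Data.Rational using (mkℚ; NonZero; _+_; -_; _/_; 1/_; _≤?_; _<?_; nonNegative; nonPositive)
open import Data.Rational.Properties
  using ( _≟_; +-*-ring; +-*-commutativeRing; normalize-coprime
        ; +-identityˡ; +-identityʳ; +-inverseʳ; +-assoc; *-comm; *-assoc; *-identityʳ; *-zeroˡ; *-zeroʳ; *-inverseˡ
        ; ≤-refl; ≤-reflexive; ≤-trans; ≤-total; <-≤-trans; +-mono-≤; +-monoˡ-≤; +-monoʳ-≤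
        ; *-monoˡ-≤-nonNeg; *-monoˡ-≤-nonPos; module ≤-Reasoning)
import Data.Sum as Sum
open import Data.Sum using ([_,_]′)
open import Data.Sum.Properties using (inj₁-injective; inj₂-injective)
open import Data.Vec.Functional using (_∷_; [])
open import Function using (_∘_)
open import Level using (0ℓ)
open import Relation.Binary.Definitions using (tri<; tri≈; tri>)
open import Relation.Binary.PropositionalEquality using (refl; sym; trans; cong; cong₂; subst; module ≡-Reasoning)
open import Relation.Nullary using (¬_; ¬?; yes; no; contradiction; ofʸ; ofⁿ)
open import Relation.Nullary.Decidable using (from-yes; dec⇒maybe)
open import Tactic.RingSolver using (solve-∀)
open import Tactic.RingSolver.Core.AlmostCommutativeRing using (AlmostCommutativeRing; fromCommutativeRing)

open import Algebra.Properties.Semiring.Sum (Ring.semiring +-*-ring)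
  using (sum; sum-cong-≗; sum-remove; sum-replicate-zero; sum-permute; ∑-distrib-+; ∑-comm; *-distribˡ-sum; *-distribʳ-sum)

ℚ-ring : AlmostCommutativeRing 0ℓ 0ℓ
ℚ-ring = fromCommutativeRing +-*-commutativeRing (λ x → dec⇒maybe (0ℚ ≟ x))

≤-via-difference : ∀ {x y} z → y - x ≡ z → 0ℚ ≤ z → x ≤ y
≤-via-difference {x} {y} z y-x≡z 0≤z = begin
  x             ≡⟨ +-identityʳ x ⟨
  x + 0ℚ        ≤⟨ +-monoʳ-≤ x 0≤z ⟩
  x + z         ≡⟨ cong (x +_) y-x≡z ⟨
  x + (y - x)   ≡⟨ x+[y-x]≡y x y ⟩
  y             ∎
  where
  open ≤-Reasoning
  x+[y-x]≡y : ∀ x y → x + (y - x) ≡ y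
  x+[y-x]≡y = solve-∀ ℚ-ring

*-nonNeg : ∀ {x y} → 0ℚ ≤ x → 0ℚ ≤ y → 0ℚ ≤ x * y
*-nonNeg {x} {y} 0≤x 0≤y = subst (_≤ x * y) (*-zeroʳ x) (*-monoˡ-≤-nonNeg x {{nonNegative 0≤x}} 0≤y)

square-nonNeg : ∀ x → 0ℚ ≤ x * x
square-nonNeg x with ≤-total 0ℚ x
... | inj₁ 0≤x = *-nonNeg 0≤x 0≤x
... | inj₂ x≤0 = subst (_≤ x * x) (*-zeroʳ x) (*-monoˡ-≤-nonPos x {{nonPositive x≤0}} x≤0)

0≤½ : 0ℚ ≤ ½
0≤½ = from-yes (0ℚ ≤? ½)

0≤-difference : ∀ {x y} → x ≤ y → 0ℚ ≤ y - x
0≤-difference {x} {y} x≤y = subst (_≤ y - x) (+-inverseʳ x) (+-monoˡ-≤ (- x) x≤y)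

fromℤ : ℤ → ℚ
fromℤ i = i / 1

fromℕ : ℕ → ℚ
fromℕ n = fromℤ (ℤ.+ n)

fromℤ≡mkℚ : ∀ i → fromℤ i ≡ mkℚ i 0 (Coprime.sym (Coprime.1-coprimeTo ℤ.∣ i ∣))
fromℤ≡mkℚ (ℤ.+ n)   = normalize-coprime (Coprime.sym (Coprime.1-coprimeTo n))
fromℤ≡mkℚ -[1+ n ]  = cong -_ (normalize-coprime (Coprime.sym (Coprime.1-coprimeTo (ℕ.suc n))))

fromℤ-+ : ∀ i j → fromℤ (i ℤ.+ j) ≡ fromℤ i + fromℤ j
fromℤ-+ i j rewrite fromℤ≡mkℚ i | fromℤ≡mkℚ j =
  cong₂ (λ x y → (x ℤ.+ y) / 1) (sym (ℤ.*-identityʳ i)) (sym (ℤ.*-identityʳ j))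

fromℤ-* : ∀ i j → fromℤ (i ℤ.* j) ≡ fromℤ i * fromℤ j
fromℤ-* i j rewrite fromℤ≡mkℚ i | fromℤ≡mkℚ j = refl

fromℤ-neg : ∀ i → fromℤ (ℤ.- i) ≡ - fromℤ i
fromℤ-neg (ℤ.+ ℕ.zero)  = refl
fromℤ-neg (ℤ.+ ℕ.suc n) = refl
fromℤ-neg -[1+ n ] rewrite fromℤ≡mkℚ -[1+ n ] | fromℤ≡mkℚ (ℤ.+ ℕ.suc n) = refl

fromℤ-- : ∀ i j → fromℤ (i ℤ.- j) ≡ fromℤ i - fromℤ j
fromℤ-- i j = trans (fromℤ-+ i (ℤ.- j)) (cong (fromℤ i +_) (fromℤ-neg j))

fromℕ-* : ∀ m n → fromℕ (m ℕ.* n) ≡ fromℕ m * fromℕ n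
fromℕ-* m n = trans (cong fromℤ (ℤ.pos-* m n)) (fromℤ-* (ℤ.+ m) (ℤ.+ n))

fromℕ-suc : ∀ n → fromℕ (ℕ.suc n) ≡ 1ℚ + fromℕ n
fromℕ-suc n = fromℤ-+ (ℤ.+ 1) (ℤ.+ n)

sumFin≡sum : ∀ n (f : Fin n → ℚ) → sumFin n f ≡ sum f
sumFin≡sum ℕ.zero    f = refl
sumFin≡sum (ℕ.suc n) f = cong (f zero +_) (sumFin≡sum n (f ∘ suc))

sum-mono-≤ : ∀ {n} {f g : Fin n → ℚ} → (∀ i → f i ≤ g i) → sum f ≤ sum g
sum-mono-≤ {ℕ.zero}  f≤g = ≤-refl
sum-mono-≤ {ℕ.suc n} f≤g = +-mono-≤ (f≤g zero) (sum-mono-≤ (f≤g ∘ suc))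

sum-nonNeg : ∀ {n} {f : Fin n → ℚ} → (∀ i → 0ℚ ≤ f i) → 0ℚ ≤ sum f
sum-nonNeg {n} {f} 0≤f = subst (_≤ sum f) (sum-replicate-zero n) (sum-mono-≤ {f = λ _ → 0ℚ} 0≤f)

sum-const : ∀ n c → sum {n} (λ _ → c) ≡ fromℕ n * c
sum-const ℕ.zero    c = sym (*-zeroˡ c)
sum-const (ℕ.suc n) c = begin
  c + sum {n} (λ _ → c)   ≡⟨ cong (c +_) (sum-const n c) ⟩
  c + fromℕ n * c         ≡⟨ c+n*c≡[1+n]*c c (fromℕ n) ⟩
  (1ℚ + fromℕ n) * c      ≡⟨ cong (_* c) (fromℕ-suc n) ⟨
  fromℕ (ℕ.suc n) * c     ∎
  where
  open ≡-Reasoning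
  c+n*c≡[1+n]*c : ∀ c n → c + n * c ≡ (1ℚ + n) * c
  c+n*c≡[1+n]*c = solve-∀ ℚ-ring

sum-+-const : ∀ {n} (f : Fin n → ℚ) c → sum (λ i → f i + c) ≡ sum f + fromℕ n * c
sum-+-const {n} f c = trans (∑-distrib-+ f (λ _ → c)) (cong (sum f +_) (sum-const n c))

sum-≥-const : ∀ {n} {f : Fin n → ℚ} c → (∀ i → c ≤ f i) → fromℕ n * c ≤ sum f
sum-≥-const {n} {f} c c≤f = subst (_≤ sum f) (sum-const n c) (sum-mono-≤ c≤f)

∑-distrib-- : ∀ {n} (f g : Fin n → ℚ) → sum (λ i → f i - g i) ≡ sum f - sum g
∑-distrib-- {ℕ.zero}  f g = refl
∑-distrib-- {ℕ.suc n} f g =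
  trans (cong (f zero - g zero +_) (∑-distrib-- (f ∘ suc) (g ∘ suc)))
        (a-b+[c-d]≡a+c-[b+d] (f zero) (g zero) (sum (f ∘ suc)) (sum (g ∘ suc)))
  where
  a-b+[c-d]≡a+c-[b+d] : ∀ a b c d → a - b + (c - d) ≡ a + c - (b + d)
  a-b+[c-d]≡a+c-[b+d] = solve-∀ ℚ-ring

∑-sub-permute≡0 : ∀ {n} (σ : Permutation n n) (h : Fin n → ℚ) → sum (λ i → h i - h (σ ⟨$⟩ʳ i)) ≡ 0ℚ
∑-sub-permute≡0 σ h = begin
  sum (λ i → h i - h (σ ⟨$⟩ʳ i))   ≡⟨ ∑-distrib-- h (h ∘ (σ ⟨$⟩ʳ_)) ⟩
  sum h - sum (h ∘ (σ ⟨$⟩ʳ_))      ≡⟨ cong (λ z → sum h - z) (sum-permute h σ) ⟨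
  sum h - sum h                     ≡⟨ +-inverseʳ (sum h) ⟩
  0ℚ                                ∎
  where open ≡-Reasoning

term-≤-sum : ∀ {n} {f : Fin n → ℚ} → (∀ i → 0ℚ ≤ f i) → ∀ i → f i ≤ sum f
term-≤-sum {ℕ.suc n} {f} 0≤f i = begin
  f i                         ≡⟨ +-identityʳ (f i) ⟨
  f i + 0ℚ                    ≤⟨ +-monoʳ-≤ (f i) (sum-nonNeg (0≤f ∘ punchIn i)) ⟩
  f i + sum (f ∘ punchIn i)   ≡⟨ sum-remove f ⟨
  sum f                       ∎
  where open ≤-Reasoning

sum-injective-≤ : ∀ {m n} {f : Fin n → ℚ} (ψ : Fin m → Fin n) → Injective _≡_ _≡_ ψ →
                  (∀ i → 0ℚ ≤ f i) → sum (f ∘ ψ) ≤ sum f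
sum-injective-≤ {ℕ.zero}            ψ ψ-inj 0≤f = sum-nonNeg 0≤f
sum-injective-≤ {ℕ.suc m} {ℕ.zero}  ψ ψ-inj 0≤f with () ← ψ zero
sum-injective-≤ {ℕ.suc m} {ℕ.suc n} {f} ψ ψ-inj 0≤f = begin
  f (ψ zero) + sum (f ∘ ψ ∘ suc)
    ≡⟨ cong (f (ψ zero) +_) (sum-cong-≗ (cong f ∘ sym ∘ punchIn-punchOut ∘ ψ₀≢)) ⟩
  f (ψ zero) + sum (f ∘ punchIn (ψ zero) ∘ ψ′)
    ≤⟨ +-monoʳ-≤ (f (ψ zero)) (sum-injective-≤ ψ′ ψ′-inj (0≤f ∘ punchIn (ψ zero))) ⟩
  f (ψ zero) + sum (f ∘ punchIn (ψ zero))
    ≡⟨ sum-remove f ⟨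
  sum f ∎
  where
  open ≤-Reasoning
  ψ₀≢ : ∀ k → ψ zero ≢ ψ (suc k)
  ψ₀≢ k eq with () ← ψ-inj eq
  ψ′ : Fin m → Fin n
  ψ′ k = punchOut (ψ₀≢ k)
  ψ′-inj : Injective _≡_ _≡_ ψ′
  ψ′-inj eq = suc-injective (ψ-inj (punchOut-injective (ψ₀≢ _) (ψ₀≢ _) eq))

sum-splitAt : ∀ m {n} (g : Fin m ⊎ Fin n → ℚ) → sum (g ∘ splitAt m) ≡ sum (g ∘ inj₁) + sum (g ∘ inj₂)
sum-splitAt ℕ.zero    g = sym (+-identityˡ _)
sum-splitAt (ℕ.suc m) g = trans (cong (g (inj₁ zero) +_) (sum-splitAt m (g ∘ Sum.map₁ suc)))
                                (sym (+-assoc (g (inj₁ zero)) _ _))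

sum-remQuot : ∀ m {n} (g : Fin m × Fin n → ℚ) → sum (g ∘ remQuot n) ≡ sum (λ i → sum (λ j → g (i , j)))
sum-remQuot ℕ.zero    g = refl
sum-remQuot (ℕ.suc m) {n} g = trans (sum-splitAt n (g ∘ swap ∘ [ (_, zero) , Product.map₂ suc ∘ quotRem n ]′))
                                    (cong (sum (λ j → g (zero , j)) +_) (sum-remQuot m (g ∘ Product.map₁ suc)))

splitAt-injective : ∀ m {n} → Injective _≡_ _≡_ (splitAt m {n})
splitAt-injective m {n} {i} {j} eq =
  trans (sym (join-splitAt m n i)) (trans (cong (join m n) eq) (join-splitAt m n j))

remQuot-injective : ∀ m {n} → Injective _≡_ _≡_ (remQuot {m} n)
remQuot-injective m {n} {i} {j} eq =
  trans (sym (combine-remQuot {m} n i)) (trans (cong (uncurry combine) eq) (combine-remQuot {m} n j))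

⊎-map-injective : ∀ {A B C D : Set} {f : A → C} {g : B → D} →
                  Injective _≡_ _≡_ f → Injective _≡_ _≡_ g → Injective _≡_ _≡_ (Sum.map f g)
⊎-map-injective f-inj g-inj {inj₁ _} {inj₁ _} eq = cong inj₁ (f-inj (inj₁-injective eq))
⊎-map-injective f-inj g-inj {inj₂ _} {inj₂ _} eq = cong inj₂ (g-inj (inj₂-injective eq))

∷₃-injective : ∀ {n} {a b c : Fin n} → a ≢ b → a ≢ c → b ≢ c → Injective _≡_ _≡_ (a ∷ b ∷ c ∷ [])
∷₃-injective a≢b a≢c b≢c {0F} {0F} _  = refl
∷₃-injective a≢b a≢c b≢c {0F} {1F} eq = contradiction eq a≢b
∷₃-injective a≢b a≢c b≢c {0F} {2F} eq = contradiction eq a≢c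
∷₃-injective a≢b a≢c b≢c {1F} {0F} eq = contradiction (sym eq) a≢b
∷₃-injective a≢b a≢c b≢c {1F} {1F} _  = refl
∷₃-injective a≢b a≢c b≢c {1F} {2F} eq = contradiction eq b≢c
∷₃-injective a≢b a≢c b≢c {2F} {0F} eq = contradiction (sym eq) a≢c
∷₃-injective a≢b a≢c b≢c {2F} {1F} eq = contradiction (sym eq) b≢c
∷₃-injective a≢b a≢c b≢c {2F} {2F} _  = refl

BlockIndex : ℕ → ℕ → ℕ → ℕ → Set
BlockIndex p q r s = ((Fin p × Fin 5) ⊎ (Fin q × Fin 4)) ⊎ ((Fin r × Fin 3) ⊎ (Fin s × Fin 2))

rotate₅ : Permutation 5 5
rotate₅ = permutation next5 (next5 ∘ next5 ∘ next5 ∘ next5) next5⁵≡id next5⁵≡id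
  where
  next5⁵≡id : ∀ a → next5 (next5 (next5 (next5 (next5 a)))) ≡ a
  next5⁵≡id = from-yes (Fin.all? λ a → next5 (next5 (next5 (next5 (next5 a)))) Fin.≟ a)

next5-fixpointFree : ∀ a → next5 a ≢ a
next5-fixpointFree = from-yes (Fin.all? λ a → ¬? (next5 a Fin.≟ a))

next5²-fixpointFree : ∀ a → next5 (next5 a) ≢ a
next5²-fixpointFree = from-yes (Fin.all? λ a → ¬? (next5 (next5 a) Fin.≟ a))

module Excess {t : ℕ} (ω : Fin t → Fin t → ℚ) (ω-½∨1 : ∀ i j → ω i j ≡ ½ ⊎ ω i j ≡ 1ℚ)
              (ω-sym : ∀ i j → ω i j ≡ ω j i) (u : Fin t → ℚ) (u≥0 : ∀ i → 0ℚ ≤ u i) where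

  lagrangianTerm : Fin t → Fin t → ℚ
  lagrangianTerm i j = if toℕ i <ᵇ toℕ j then ω i j * u i * u j else 0ℚ

  defect : Fin t → Fin t → ℚ
  defect i j = u i * u j - (lagrangianTerm i j + lagrangianTerm j i)

  excess : ℚ → Fin t → ℚ
  excess μ i = sum (defect i) - two * μ * u i + μ * μ

  0≤ω : ∀ i j → 0ℚ ≤ ω i j
  0≤ω i j with ω-½∨1 i j
  ... | inj₁ ω≡½ = subst (0ℚ ≤_) (sym ω≡½) 0≤½
  ... | inj₂ ω≡1 = subst (0ℚ ≤_) (sym ω≡1) (from-yes (0ℚ ≤? 1ℚ))

  0≤1-ω : ∀ i j → 0ℚ ≤ 1ℚ - ω i j
  0≤1-ω i j with ω-½∨1 i j
  ... | inj₁ ω≡½ = subst (λ w → 0ℚ ≤ 1ℚ - w) (sym ω≡½) 0≤½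
  ... | inj₂ ω≡1 = subst (λ w → 0ℚ ≤ 1ℚ - w) (sym ω≡1) (from-yes (0ℚ ≤? 1ℚ - 1ℚ))

  lagrangianTerm-< : ∀ {i j} → toℕ i ℕ.< toℕ j → lagrangianTerm i j ≡ ω i j * u i * u j
  lagrangianTerm-< {i} {j} i<j with toℕ i <ᵇ toℕ j | ℕ.<ᵇ-reflects-< (toℕ i) (toℕ j)
  ... | true  | _        = refl
  ... | false | ofⁿ i≮j = contradiction i<j i≮j

  lagrangianTerm-≮ : ∀ {i j} → ¬ toℕ i ℕ.< toℕ j → lagrangianTerm i j ≡ 0ℚ
  lagrangianTerm-≮ {i} {j} i≮j with toℕ i <ᵇ toℕ j | ℕ.<ᵇ-reflects-< (toℕ i) (toℕ j)
  ... | true  | ofʸ i<j = contradiction i<j i≮j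
  ... | false | _        = refl

  lagrangianTerm-nonNeg : ∀ i j → 0ℚ ≤ lagrangianTerm i j
  lagrangianTerm-nonNeg i j with toℕ i <ᵇ toℕ j
  ... | true  = *-nonNeg (*-nonNeg (0≤ω i j) (u≥0 i)) (u≥0 j)
  ... | false = ≤-refl

  lagrangian≡∑∑lagrangianTerm : lagrangian t ω u ≡ sum (λ i → sum (lagrangianTerm i))
  lagrangian≡∑∑lagrangianTerm = trans (sumFin≡sum t _) (sum-cong-≗ (λ i → sumFin≡sum t (lagrangianTerm i)))

  lagrangian-nonNeg : 0ℚ ≤ lagrangian t ω u
  lagrangian-nonNeg = subst (0ℚ ≤_) (sym lagrangian≡∑∑lagrangianTerm) (sum-nonNeg (sum-nonNeg ∘ lagrangianTerm-nonNeg))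

  defect-diag : ∀ i → defect i i ≡ u i * u i
  defect-diag i rewrite lagrangianTerm-≮ {i} {i} (ℕ.<-irrefl refl) = +-identityʳ (u i * u i)

  defect-off : ∀ {i j} → i ≢ j → defect i j ≡ (1ℚ - ω i j) * (u i * u j)
  defect-off {i} {j} i≢j with ℕ.<-cmp (toℕ i) (toℕ j)
  ... | tri< i<j _ j≮i rewrite lagrangianTerm-< i<j | lagrangianTerm-≮ j≮i = lower (ω i j) (u i) (u j)
    where
    lower : ∀ w x y → x * y - (w * x * y + 0ℚ) ≡ (1ℚ - w) * (x * y)
    lower = solve-∀ ℚ-ring
  ... | tri≈ _ i≡j _ = contradiction (toℕ-injective i≡j) i≢j
  ... | tri> i≮j _ j<i rewrite lagrangianTerm-≮ i≮j | lagrangianTerm-< j<i | ω-sym j i = upper (ω i j) (u i) (u j)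
    where
    upper : ∀ w x y → x * y - (0ℚ + w * y * x) ≡ (1ℚ - w) * (x * y)
    upper = solve-∀ ℚ-ring

  defect-nonNeg : ∀ i j → 0ℚ ≤ defect i j
  defect-nonNeg i j with i Fin.≟ j
  ... | yes refl = subst (0ℚ ≤_) (sym (defect-diag i)) (square-nonNeg (u i))
  ... | no i≢j   = subst (0ℚ ≤_) (sym (defect-off i≢j)) (*-nonNeg (0≤1-ω i j) (*-nonNeg (u≥0 i) (u≥0 j)))

  defect-half : ∀ {i j} → i ≢ j → ω i j ≡ ½ → defect i j ≡ ½ * (u i * u j)
  defect-half {i} {j} i≢j ω≡½ = trans (defect-off i≢j) (cong (λ w → (1ℚ - w) * (u i * u j)) ω≡½)

  sum-defect : sum u ≡ 1ℚ → sum (λ i → sum (defect i)) ≡ 1ℚ - two * lagrangian t ω u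
  sum-defect Σu≡1 = begin
    sum (λ i → sum (defect i))
      ≡⟨ sum-cong-≗ (λ i → ∑-distrib-- (λ j → u i * u j) (λ j → e i j + e j i)) ⟩
    sum (λ i → sum (λ j → u i * u j) - sum (λ j → e i j + e j i))
      ≡⟨ ∑-distrib-- (λ i → sum (λ j → u i * u j)) (λ i → sum (λ j → e i j + e j i)) ⟩
    sum (λ i → sum (λ j → u i * u j)) - sum (λ i → sum (λ j → e i j + e j i))
      ≡⟨ cong₂ _-_ ∑∑uu≡1 ∑∑e+eᵀ≡L+L ⟩
    1ℚ - (L + L)
      ≡⟨ cong (λ z → 1ℚ - z) (L+L≡two*L L) ⟩
    1ℚ - two * L ∎
    where
    open ≡-Reasoning
    e : Fin t → Fin t → ℚ
    e = lagrangianTerm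
    L : ℚ
    L = lagrangian t ω u
    L+L≡two*L : ∀ L → L + L ≡ two * L
    L+L≡two*L = solve-∀ ℚ-ring
    ∑∑uu≡1 : sum (λ i → sum (λ j → u i * u j)) ≡ 1ℚ
    ∑∑uu≡1 = begin
      sum (λ i → sum (λ j → u i * u j))   ≡⟨ sum-cong-≗ (λ i → *-distribˡ-sum (u i) u) ⟨
      sum (λ i → u i * sum u)             ≡⟨ *-distribʳ-sum (sum u) u ⟨
      sum u * sum u                       ≡⟨ cong₂ _*_ Σu≡1 Σu≡1 ⟩
      1ℚ                                  ∎
    ∑∑e+eᵀ≡L+L : sum (λ i → sum (λ j → e i j + e j i)) ≡ L + L
    ∑∑e+eᵀ≡L+L = begin
      sum (λ i → sum (λ j → e i j + e j i))
        ≡⟨ sum-cong-≗ (λ i → ∑-distrib-+ (e i) (λ j → e j i)) ⟩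
      sum (λ i → sum (e i) + sum (λ j → e j i))
        ≡⟨ ∑-distrib-+ (λ i → sum (e i)) (λ i → sum (λ j → e j i)) ⟩
      sum (λ i → sum (e i)) + sum (λ i → sum (λ j → e j i))
        ≡⟨ cong (sum (λ i → sum (e i)) +_) (∑-comm (λ j i → e j i)) ⟨
      sum (λ i → sum (e i)) + sum (λ i → sum (e i))
        ≡⟨ cong₂ _+_ lagrangian≡∑∑lagrangianTerm lagrangian≡∑∑lagrangianTerm ⟨
      L + L ∎

  sum-excess : sum u ≡ 1ℚ → ∀ μ → sum (excess μ) ≡ 1ℚ - two * lagrangian t ω u - two * μ + fromℕ t * (μ * μ)
  sum-excess Σu≡1 μ = begin
    sum (excess μ)
      ≡⟨ sum-+-const (λ i → sum (defect i) - two * μ * u i) (μ * μ) ⟩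
    sum (λ i → sum (defect i) - two * μ * u i) + fromℕ t * (μ * μ)
      ≡⟨ cong (_+ fromℕ t * (μ * μ)) (∑-distrib-- (λ i → sum (defect i)) (λ i → two * μ * u i)) ⟩
    sum (λ i → sum (defect i)) - sum (λ i → two * μ * u i) + fromℕ t * (μ * μ)
      ≡⟨ cong₂ (λ a b → a - b + fromℕ t * (μ * μ)) (sum-defect Σu≡1) (sym (*-distribˡ-sum (two * μ) u)) ⟩
    1ℚ - two * lagrangian t ω u - two * μ * sum u + fromℕ t * (μ * μ)
      ≡⟨ cong (λ z → 1ℚ - two * lagrangian t ω u - two * μ * z + fromℕ t * (μ * μ)) Σu≡1 ⟩
    1ℚ - two * lagrangian t ω u - two * μ * 1ℚ + fromℕ t * (μ * μ)
      ≡⟨ cong (λ z → 1ℚ - two * lagrangian t ω u - z + fromℕ t * (μ * μ)) (*-identityʳ (two * μ)) ⟩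
    1ℚ - two * lagrangian t ω u - two * μ + fromℕ t * (μ * μ) ∎
    where open ≡-Reasoning

  excess-nonNeg : ∀ μ i → 0ℚ ≤ excess μ i
  excess-nonNeg μ i = ≤-trans (square-nonNeg (u i - μ))
    (≤-via-difference _ (completeSquare (sum (defect i)) (u i) μ) (0≤-difference u²≤row))
    where
    completeSquare : ∀ R x μ → (R - two * μ * x + μ * μ) - (x - μ) * (x - μ) ≡ R - x * x
    completeSquare = solve-∀ ℚ-ring
    u²≤row : u i * u i ≤ sum (defect i)
    u²≤row = subst (_≤ sum (defect i)) (defect-diag i) (term-≤-sum (defect-nonNeg i) i)

  subrow-≤-excess : ∀ {m} (w : Fin m → Fin t) → Injective _≡_ _≡_ w →
                 ∀ μ i → sum (defect i ∘ w) - two * μ * u i + μ * μ ≤ excess μ i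
  subrow-≤-excess w w-inj μ i =
    +-monoˡ-≤ (μ * μ) (+-monoˡ-≤ (- (two * μ * u i)) (sum-injective-≤ w w-inj (defect-nonNeg i)))

  clique-row : ∀ {k} (v : Fin k → Fin t) → Injective _≡_ _≡_ v → (∀ a b → a ≢ b → ω (v a) (v b) ≡ ½) →
               ∀ a → sum (defect (v a) ∘ v) ≡ ½ * (u (v a) * u (v a)) + ½ * (u (v a) * sum (u ∘ v))
  clique-row {ℕ.suc k} v v-inj half a = begin
    sum (defect (v a) ∘ v)
      ≡⟨ sum-remove {i = a} (defect (v a) ∘ v) ⟩
    defect (v a) (v a) + sum (defect (v a) ∘ v ∘ punchIn a)
      ≡⟨ cong₂ _+_ (defect-diag (v a)) (sum-cong-≗ off-diagonal) ⟩
    x a * x a + sum (λ b → ½ * (x a * x (punchIn a b)))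
      ≡⟨ cong (x a * x a +_) scale-out ⟩
    x a * x a + ½ * (x a * sum (x ∘ punchIn a))
      ≡⟨ halve (x a) (sum (x ∘ punchIn a)) ⟩
    ½ * (x a * x a) + ½ * (x a * (x a + sum (x ∘ punchIn a)))
      ≡⟨ cong (λ S → ½ * (x a * x a) + ½ * (x a * S)) (sum-remove {i = a} x) ⟨
    ½ * (x a * x a) + ½ * (x a * sum x) ∎
    where
    open ≡-Reasoning
    x : Fin (ℕ.suc k) → ℚ
    x = u ∘ v
    off-diagonal : ∀ b → defect (v a) (v (punchIn a b)) ≡ ½ * (x a * x (punchIn a b))
    off-diagonal b = defect-half (punchInᵢ≢i a b ∘ sym ∘ v-inj) (half a (punchIn a b) (punchInᵢ≢i a b ∘ sym))
    scale-out : sum (λ b → ½ * (x a * x (punchIn a b))) ≡ ½ * (x a * sum (x ∘ punchIn a))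
    scale-out = sym (trans (cong (½ *_) (*-distribˡ-sum (x a) (x ∘ punchIn a))) (*-distribˡ-sum ½ (λ b → x a * x (punchIn a b))))
    halve : ∀ x r → x * x + ½ * (x * r) ≡ ½ * (x * x) + ½ * (x * (x + r))
    halve = solve-∀ ℚ-ring

  clique-excess : ∀ {k} (v : Fin k → Fin t) → Injective _≡_ _≡_ v → (∀ a b → a ≢ b → ω (v a) (v b) ≡ ½) →
                  ∀ μ ν → fromℕ k * (μ * μ - ½ * (ν * ν)) - ½ * ((two * μ - ν) * (two * μ - ν)) ≤ sum (excess μ ∘ v)
  clique-excess {k} v v-inj half μ ν = begin
    fromℕ k * δ - ½ * ((two * μ - ν) * (two * μ - ν))
      ≤⟨ ≤-via-difference _ (completeSquareₛ S μ ν (fromℕ k * δ)) (*-nonNeg 0≤½ (square-nonNeg (S - (two * μ - ν)))) ⟩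
    κ * S + fromℕ k * δ
      ≡⟨ cong (_+ fromℕ k * δ) (*-distribˡ-sum κ x) ⟩
    sum (λ a → κ * x a) + fromℕ k * δ
      ≡⟨ sum-+-const (λ a → κ * x a) δ ⟨
    sum (λ a → κ * x a + δ)
      ≤⟨ sum-mono-≤ vertex ⟩
    sum (excess μ ∘ v) ∎
    where
    open ≤-Reasoning
    x : Fin k → ℚ
    x = u ∘ v
    S κ δ : ℚ
    S = sum x
    κ = ν + ½ * S - two * μ
    δ = μ * μ - ½ * (ν * ν)
    completeSquareₛ : ∀ S μ ν D → ((ν + ½ * S - two * μ) * S + D) - (D - ½ * ((two * μ - ν) * (two * μ - ν)))
                                 ≡ ½ * ((S - (two * μ - ν)) * (S - (two * μ - ν)))
    completeSquareₛ = solve-∀ ℚ-ring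
    completeSquareₓ : ∀ x S μ ν → (½ * (x * x) + ½ * (x * S) - two * μ * x + μ * μ)
                                  - ((ν + ½ * S - two * μ) * x + (μ * μ - ½ * (ν * ν)))
                                ≡ ½ * ((x - ν) * (x - ν))
    completeSquareₓ = solve-∀ ℚ-ring
    vertex : ∀ a → κ * x a + δ ≤ excess μ (v a)
    vertex a = begin
      κ * x a + δ
        ≤⟨ ≤-via-difference _ (completeSquareₓ (x a) S μ ν) (*-nonNeg 0≤½ (square-nonNeg (x a - ν))) ⟩
      ½ * (x a * x a) + ½ * (x a * S) - two * μ * x a + μ * μ
        ≡⟨ cong (λ z → z - two * μ * x a + μ * μ) (clique-row v v-inj half a) ⟨
      sum (defect (v a) ∘ v) - two * μ * x a + μ * μ
        ≤⟨ subrow-≤-excess v v-inj μ (v a) ⟩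
      excess μ (v a) ∎

  cycle-excess : ∀ {k} (v : Fin k → Fin t) → Injective _≡_ _≡_ v → (σ : Permutation k k) →
                 (∀ a → σ ⟨$⟩ʳ a ≢ a) → (∀ a → σ ⟨$⟩ʳ (σ ⟨$⟩ʳ a) ≢ a) →
                 (∀ a → ω (v a) (v (σ ⟨$⟩ʳ a)) ≡ ½) →
                 ∀ μ → fromℕ k * (½ * (μ * μ)) ≤ sum (excess μ ∘ v)
  cycle-excess {k} v v-inj σ no-fixpoint no-2-cycle half μ = begin
    fromℕ k * (½ * (μ * μ))
      ≡⟨ +-identityˡ _ ⟨
    0ℚ + fromℕ k * (½ * (μ * μ))
      ≡⟨ cong (_+ fromℕ k * (½ * (μ * μ))) (∑-sub-permute≡0 σ h) ⟨
    sum (λ a → h a - h (σ⁺ a)) + fromℕ k * (½ * (μ * μ))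
      ≡⟨ sum-+-const (λ a → h a - h (σ⁺ a)) (½ * (μ * μ)) ⟨
    sum (λ a → h a - h (σ⁺ a) + ½ * (μ * μ))
      ≤⟨ sum-mono-≤ vertex ⟩
    sum (excess μ ∘ v) ∎
    where
    open ≤-Reasoning
    σ⁺ σ⁻ : Fin k → Fin k
    σ⁺ = σ ⟨$⟩ʳ_
    σ⁻ = σ ⟨$⟩ˡ_
    x : Fin k → ℚ
    x = u ∘ v
    h : Fin k → ℚ
    h a = ½ * (x a * x (σ⁻ a)) + ½ * (x a * x a) - μ * x a
    a≢σ⁺a : ∀ a → a ≢ σ⁺ a
    a≢σ⁺a a = no-fixpoint a ∘ sym
    a≢σ⁻a : ∀ a → a ≢ σ⁻ a
    a≢σ⁻a a a≡σ⁻a = no-fixpoint a (trans (cong σ⁺ a≡σ⁻a) (inverseʳ σ))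
    σ⁺a≢σ⁻a : ∀ a → σ⁺ a ≢ σ⁻ a
    σ⁺a≢σ⁻a a σ⁺a≡σ⁻a = no-2-cycle a (trans (cong σ⁺ σ⁺a≡σ⁻a) (inverseʳ σ))
    neighbours : Fin k → Fin 3 → Fin k
    neighbours a = a ∷ σ⁺ a ∷ σ⁻ a ∷ []
    neighbours-injective : ∀ a → Injective _≡_ _≡_ (v ∘ neighbours a)
    neighbours-injective a = ∷₃-injective (a≢σ⁺a a) (a≢σ⁻a a) (σ⁺a≢σ⁻a a) ∘ v-inj
    half⁻ : ∀ a → ω (v a) (v (σ⁻ a)) ≡ ½
    half⁻ a = trans (ω-sym _ _) (trans (cong (ω (v (σ⁻ a)) ∘ v) (sym (inverseʳ σ))) (half (σ⁻ a)))
    row : ∀ a → sum (defect (v a) ∘ v ∘ neighbours a) ≡ x a * x a + (½ * (x a * x (σ⁺ a)) + (½ * (x a * x (σ⁻ a)) + 0ℚ))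
    row a = cong₂ _+_ (defect-diag (v a))
      (cong₂ _+_ (defect-half (a≢σ⁺a a ∘ v-inj) (half a))
                 (cong (_+ 0ℚ) (defect-half (a≢σ⁻a a ∘ v-inj) (half⁻ a))))
    telescope : ∀ x y z μ → (x * x + (½ * (x * y) + (½ * (x * z) + 0ℚ)) - two * μ * x + μ * μ)
                            - ((½ * (x * z) + ½ * (x * x) - μ * x) - (½ * (y * x) + ½ * (y * y) - μ * y) + ½ * (μ * μ))
                          ≡ ½ * ((x + y - μ) * (x + y - μ))
    telescope = solve-∀ ℚ-ring
    h∘σ⁺ : ∀ a → h (σ⁺ a) ≡ ½ * (x (σ⁺ a) * x a) + ½ * (x (σ⁺ a) * x (σ⁺ a)) - μ * x (σ⁺ a)
    h∘σ⁺ a = cong (λ z → ½ * (x (σ⁺ a) * x z) + ½ * (x (σ⁺ a) * x (σ⁺ a)) - μ * x (σ⁺ a)) (inverseˡ σ)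
    vertex : ∀ a → h a - h (σ⁺ a) + ½ * (μ * μ) ≤ excess μ (v a)
    vertex a = begin
      h a - h (σ⁺ a) + ½ * (μ * μ)
        ≡⟨ cong (λ z → h a - z + ½ * (μ * μ)) (h∘σ⁺ a) ⟩
      h a - (½ * (x (σ⁺ a) * x a) + ½ * (x (σ⁺ a) * x (σ⁺ a)) - μ * x (σ⁺ a)) + ½ * (μ * μ)
        ≤⟨ ≤-via-difference _ (telescope (x a) (x (σ⁺ a)) (x (σ⁻ a)) μ)
                              (*-nonNeg 0≤½ (square-nonNeg (x a + x (σ⁺ a) - μ))) ⟩
      x a * x a + (½ * (x a * x (σ⁺ a)) + (½ * (x a * x (σ⁻ a)) + 0ℚ)) - two * μ * x a + μ * μ
        ≡⟨ cong (λ z → z - two * μ * x a + μ * μ) (row a) ⟨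
      sum (defect (v a) ∘ v ∘ neighbours a) - two * μ * x a + μ * μ
        ≤⟨ subrow-≤-excess (v ∘ neighbours a) (neighbours-injective a) μ (v a) ⟩
      excess μ (v a) ∎

  module Blocks {p q r s : ℕ} (φ : BlockIndex p q r s → Fin t) (φ-inj : Injective _≡_ _≡_ φ)
    (C₅-half : ∀ a k → ω (φ (inj₁ (inj₁ (a , k)))) (φ (inj₁ (inj₁ (a , next5 k)))) ≡ ½)
    (K₄-half : ∀ a k l → k ≢ l → ω (φ (inj₁ (inj₂ (a , k)))) (φ (inj₁ (inj₂ (a , l)))) ≡ ½)
    (K₃-half : ∀ a k l → k ≢ l → ω (φ (inj₂ (inj₁ (a , k)))) (φ (inj₂ (inj₁ (a , l)))) ≡ ½)
    (K₂-half : ∀ a k l → k ≢ l → ω (φ (inj₂ (inj₂ (a , k)))) (φ (inj₂ (inj₂ (a , l)))) ≡ ½) where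

    block-injective : ∀ {m k} (ι : Fin m × Fin k → BlockIndex p q r s) → Injective _≡_ _≡_ ι →
                      ∀ a → Injective _≡_ _≡_ (φ ∘ ι ∘ (a ,_))
    block-injective ι ι-inj a = ,-injectiveʳ ∘ ι-inj ∘ φ-inj

    C₅-block : ∀ μ a → (ℤ.+ 5 / 2) * (μ * μ) ≤ sum (λ k → excess μ (φ (inj₁ (inj₁ (a , k)))))
    C₅-block μ a = ≤-trans (≤-reflexive (constant μ))
      (cycle-excess _ (block-injective (inj₁ ∘ inj₁) (inj₁-injective ∘ inj₁-injective) a)
                    rotate₅ next5-fixpointFree next5²-fixpointFree (C₅-half a) μ)
      where
      constant : ∀ μ → (ℤ.+ 5 / 2) * (μ * μ) ≡ fromℕ 5 * (½ * (μ * μ))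
      constant = solve-∀ ℚ-ring

    -- ν = 2μ/(k+1) optimises clique-excess.
    K₄-block : ∀ μ a → (ℤ.+ 12 / 5) * (μ * μ) ≤ sum (λ k → excess μ (φ (inj₁ (inj₂ (a , k)))))
    K₄-block μ a = ≤-trans (≤-reflexive (constant μ))
      (clique-excess _ (block-injective (inj₁ ∘ inj₂) (inj₂-injective ∘ inj₁-injective) a) (K₄-half a) μ ((ℤ.+ 2 / 5) * μ))
      where
      constant : ∀ μ → (ℤ.+ 12 / 5) * (μ * μ)
                     ≡ fromℕ 4 * (μ * μ - ½ * ((ℤ.+ 2 / 5) * μ * ((ℤ.+ 2 / 5) * μ)))
                       - ½ * ((two * μ - (ℤ.+ 2 / 5) * μ) * (two * μ - (ℤ.+ 2 / 5) * μ))
      constant = solve-∀ ℚ-ring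

    K₃-block : ∀ μ a → (ℤ.+ 3 / 2) * (μ * μ) ≤ sum (λ k → excess μ (φ (inj₂ (inj₁ (a , k)))))
    K₃-block μ a = ≤-trans (≤-reflexive (constant μ))
      (clique-excess _ (block-injective (inj₂ ∘ inj₁) (inj₁-injective ∘ inj₂-injective) a) (K₃-half a) μ (½ * μ))
      where
      constant : ∀ μ → (ℤ.+ 3 / 2) * (μ * μ)
                     ≡ fromℕ 3 * (μ * μ - ½ * (½ * μ * (½ * μ))) - ½ * ((two * μ - ½ * μ) * (two * μ - ½ * μ))
      constant = solve-∀ ℚ-ring

    K₂-block : ∀ μ a → (ℤ.+ 2 / 3) * (μ * μ) ≤ sum (λ k → excess μ (φ (inj₂ (inj₂ (a , k)))))
    K₂-block μ a = ≤-trans (≤-reflexive (constant μ))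
      (clique-excess _ (block-injective (inj₂ ∘ inj₂) (inj₂-injective ∘ inj₂-injective) a) (K₂-half a) μ ((ℤ.+ 2 / 3) * μ))
      where
      constant : ∀ μ → (ℤ.+ 2 / 3) * (μ * μ)
                     ≡ fromℕ 2 * (μ * μ - ½ * ((ℤ.+ 2 / 3) * μ * ((ℤ.+ 2 / 3) * μ)))
                       - ½ * ((two * μ - (ℤ.+ 2 / 3) * μ) * (two * μ - (ℤ.+ 2 / 3) * μ))
      constant = solve-∀ ℚ-ring

    enumerate : Fin ((p ℕ.* 5 ℕ.+ q ℕ.* 4) ℕ.+ (r ℕ.* 3 ℕ.+ s ℕ.* 2)) → BlockIndex p q r s
    enumerate = Sum.map (Sum.map (remQuot 5) (remQuot 4) ∘ splitAt (p ℕ.* 5))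
                        (Sum.map (remQuot 3) (remQuot 2) ∘ splitAt (r ℕ.* 3))
              ∘ splitAt (p ℕ.* 5 ℕ.+ q ℕ.* 4)

    enumerate-injective : Injective _≡_ _≡_ enumerate
    enumerate-injective = splitAt-injective (p ℕ.* 5 ℕ.+ q ℕ.* 4)
      ∘ ⊎-map-injective (splitAt-injective (p ℕ.* 5) ∘ ⊎-map-injective (remQuot-injective p) (remQuot-injective q))
                        (splitAt-injective (r ℕ.* 3) ∘ ⊎-map-injective (remQuot-injective r) (remQuot-injective s))

    sum-enumerate : ∀ (g : BlockIndex p q r s → ℚ) → sum (g ∘ enumerate)
      ≡ (sum (λ a → sum (λ k → g (inj₁ (inj₁ (a , k))))) + sum (λ a → sum (λ k → g (inj₁ (inj₂ (a , k))))))
      + (sum (λ a → sum (λ k → g (inj₂ (inj₁ (a , k))))) + sum (λ a → sum (λ k → g (inj₂ (inj₂ (a , k))))))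
    sum-enumerate g = trans (sum-splitAt (p ℕ.* 5 ℕ.+ q ℕ.* 4) (g ∘ Sum.map _ _)) (cong₂ _+_
      (trans (sum-splitAt (p ℕ.* 5) (g ∘ inj₁ ∘ Sum.map (remQuot 5) (remQuot 4)))
             (cong₂ _+_ (sum-remQuot p (g ∘ inj₁ ∘ inj₁)) (sum-remQuot q (g ∘ inj₁ ∘ inj₂))))
      (trans (sum-splitAt (r ℕ.* 3) (g ∘ inj₂ ∘ Sum.map (remQuot 3) (remQuot 2)))
             (cong₂ _+_ (sum-remQuot r (g ∘ inj₂ ∘ inj₁)) (sum-remQuot s (g ∘ inj₂ ∘ inj₂)))))

    blocks-≤-excess : ∀ μ → (fromℕ p * ((ℤ.+ 5 / 2) * (μ * μ)) + fromℕ q * ((ℤ.+ 12 / 5) * (μ * μ)))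
                          + (fromℕ r * ((ℤ.+ 3 / 2) * (μ * μ)) + fromℕ s * ((ℤ.+ 2 / 3) * (μ * μ)))
                          ≤ sum (excess μ)
    blocks-≤-excess μ = begin
      (fromℕ p * ((ℤ.+ 5 / 2) * (μ * μ)) + fromℕ q * ((ℤ.+ 12 / 5) * (μ * μ)))
        + (fromℕ r * ((ℤ.+ 3 / 2) * (μ * μ)) + fromℕ s * ((ℤ.+ 2 / 3) * (μ * μ)))
        ≤⟨ +-mono-≤ (+-mono-≤ (sum-≥-const _ (C₅-block μ)) (sum-≥-const _ (K₄-block μ)))
                    (+-mono-≤ (sum-≥-const _ (K₃-block μ)) (sum-≥-const _ (K₂-block μ))) ⟩
      _ ≡⟨ sum-enumerate (excess μ ∘ φ) ⟨
      sum (excess μ ∘ φ ∘ enumerate)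
        ≤⟨ sum-injective-≤ (φ ∘ enumerate) (enumerate-injective ∘ φ-inj) (excess-nonNeg μ) ⟩
      sum (excess μ) ∎
      where open ≤-Reasoning

quadratic-bound : ∀ b D → 0ℚ ≤ b → (∀ μ → thirty * (two * μ) ≤ thirty * (1ℚ - b) + D * (μ * μ)) →
                  Σ (0ℚ < D) (λ D>0 → b ≤ 1ℚ - (thirty ÷ D) {{>-nonZero D>0}})
quadratic-bound b D 0≤b bound = D>0 , b≤1-μ
  where
  thirtieth : ℚ
  thirtieth = ℤ.+ 1 / 30
  gap : ℚ → ℚ
  gap μ = thirty * (1ℚ - b) + D * (μ * μ) - thirty * (two * μ)
  D-thirty≡ : ∀ b D → D - thirty ≡ (thirty * (1ℚ - b) + D * (1ℚ * 1ℚ) - thirty * (two * 1ℚ)) + thirty * b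
  D-thirty≡ = solve-∀ ℚ-ring
  D>0 : 0ℚ < D
  D>0 = <-≤-trans (from-yes (0ℚ <? thirty))
    (≤-via-difference _ (D-thirty≡ b D) (+-mono-≤ (0≤-difference (bound 1ℚ)) (*-nonNeg (from-yes (0ℚ ≤? thirty)) 0≤b)))
  instance
    D≢0 : NonZero D
    D≢0 = >-nonZero D>0
  μ : ℚ
  μ = thirty ÷ D
  Dμ≡thirty : D * μ ≡ thirty
  Dμ≡thirty = trans (*-comm D μ)
    (trans (*-assoc thirty (1/ D) D) (trans (cong (thirty *_) (*-inverseˡ D)) (*-identityʳ thirty)))
  1-μ-b≡ : ∀ b D μ → 1ℚ - μ - b ≡ thirtieth * (thirty * (1ℚ - b) + D * (μ * μ) - thirty * (two * μ))
                                   + μ * thirtieth * (thirty - D * μ)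
  1-μ-b≡ = solve-∀ ℚ-ring
  b≤1-μ : b ≤ 1ℚ - μ
  b≤1-μ = ≤-via-difference _ 1-μ-b≡gap/30 (*-nonNeg (from-yes (0ℚ ≤? thirtieth)) (0≤-difference (bound μ)))
    where
    open ≡-Reasoning
    1-μ-b≡gap/30 : 1ℚ - μ - b ≡ thirtieth * gap μ
    1-μ-b≡gap/30 = begin
      1ℚ - μ - b
        ≡⟨ 1-μ-b≡ b D μ ⟩
      thirtieth * gap μ + μ * thirtieth * (thirty - D * μ)
        ≡⟨ cong (λ z → thirtieth * gap μ + μ * thirtieth * (thirty - z)) Dμ≡thirty ⟩
      thirtieth * gap μ + μ * thirtieth * 0ℚ
        ≡⟨ cong (thirtieth * gap μ +_) (*-zeroʳ (μ * thirtieth)) ⟩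
      thirtieth * gap μ + 0ℚ
        ≡⟨ +-identityʳ _ ⟩
      thirtieth * gap μ ∎

denom≡ : ∀ t p q r s → denom t p q r s
       ≡ thirty * fromℕ t - fromℕ 75 * fromℕ p - fromℕ 72 * fromℕ q - fromℕ 45 * fromℕ r - fromℕ 20 * fromℕ s
denom≡ t p q r s =
  trans (fromℤ-- (n 30 t ℤ.- n 75 p ℤ.- n 72 q ℤ.- n 45 r) (n 20 s)) (cong₂ _-_
    (trans (fromℤ-- (n 30 t ℤ.- n 75 p ℤ.- n 72 q) (n 45 r)) (cong₂ _-_
      (trans (fromℤ-- (n 30 t ℤ.- n 75 p) (n 72 q)) (cong₂ _-_
        (trans (fromℤ-- (n 30 t) (n 75 p)) (cong₂ _-_ (fromℕ-* 30 t) (fromℕ-* 75 p)))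
        (fromℕ-* 72 q)))
      (fromℕ-* 45 r)))
    (fromℕ-* 20 s))
  where
  n : ℕ → ℕ → ℤ
  n c x = ℤ.+ (c ℕ.* x)

lemma3p1 : (t p q r s : ℕ)
    → (ω : Fin t → Fin t → ℚ)
    → (∀ i j → ω i j ≡ ½ ⊎ ω i j ≡ 1ℚ)
    → (∀ i j → ω i j ≡ ω j i)
    → (φ : ((Fin p × Fin 5) ⊎ (Fin q × Fin 4)) ⊎ ((Fin r × Fin 3) ⊎ (Fin s × Fin 2)) → Fin t)
    → Injective _≡_ _≡_ φ
    → (∀ a k → ω (φ (inj₁ (inj₁ (a , k)))) (φ (inj₁ (inj₁ (a , next5 k)))) ≡ ½)
    → (∀ a k l → k ≢ l → ω (φ (inj₁ (inj₂ (a , k)))) (φ (inj₁ (inj₂ (a , l)))) ≡ ½)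
    → (∀ a k l → k ≢ l → ω (φ (inj₂ (inj₁ (a , k)))) (φ (inj₂ (inj₁ (a , l)))) ≡ ½)
    → (∀ a k l → k ≢ l → ω (φ (inj₂ (inj₂ (a , k)))) (φ (inj₂ (inj₂ (a , l)))) ≡ ½)
    → (u : Fin t → ℚ)
    → (∀ i → 0ℚ ≤ u i)
    → sumFin t u ≡ 1ℚ
    → Σ (0ℚ < denom t p q r s) (λ D>0 →
        two * lagrangian t ω u ≤ 1ℚ - (thirty ÷ denom t p q r s) {{>-nonZero D>0}})
lemma3p1 t p q r s ω ω-½∨1 ω-sym φ φ-inj C₅-half K₄-half K₃-half K₂-half u u≥0 Σu≡1 =
  quadratic-bound (two * L) (denom t p q r s) (*-nonNeg (from-yes (0ℚ ≤? two)) lagrangian-nonNeg) bound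
  where
  open Excess ω ω-½∨1 ω-sym u u≥0
  open Blocks φ φ-inj C₅-half K₄-half K₃-half K₂-half
  L : ℚ
  L = lagrangian t ω u
  rearrange : ∀ L T P Q R S μ →
    thirty * (1ℚ - two * L)
      + (thirty * T - fromℕ 75 * P - fromℕ 72 * Q - fromℕ 45 * R - fromℕ 20 * S) * (μ * μ)
      - thirty * (two * μ)
    ≡ thirty * ((1ℚ - two * L - two * μ + T * (μ * μ))
                - ((P * ((ℤ.+ 5 / 2) * (μ * μ)) + Q * ((ℤ.+ 12 / 5) * (μ * μ)))
                   + (R * ((ℤ.+ 3 / 2) * (μ * μ)) + S * ((ℤ.+ 2 / 3) * (μ * μ)))))
  rearrange = solve-∀ ℚ-ring
  bound : ∀ μ → thirty * (two * μ) ≤ thirty * (1ℚ - two * L) + denom t p q r s * (μ * μ)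
  bound μ = ≤-via-difference _
    (trans (cong (λ D → thirty * (1ℚ - two * L) + D * (μ * μ) - thirty * (two * μ)) (denom≡ t p q r s))
           (rearrange L (fromℕ t) (fromℕ p) (fromℕ q) (fromℕ r) (fromℕ s) μ))
    (*-nonNeg (from-yes (0ℚ ≤? thirty))
              (0≤-difference (subst (_ ≤_) (sum-excess (trans (sym (sumFin≡sum t u)) Σu≡1) μ) (blocks-≤-excess μ))))
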